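{- Let $D_1, D_2$ be digraphs such that there is a circular homomorphism $\phi: V(D_1) \to V(D_2)$. Then $\vec{\chi}^\ast(D_1) \le \vec{\chi}^\ast(D_2)$ and $\vec{\chi}_f(D_1) \le \vec{\chi}_f(D_2)$.
   Context: Digraphs are loopless but may have parallel and anti-parallel arcs. A vertex set is acyclic if it induces a subdigraph without directed cycles. A map $\phi: V(D_1)\to V(D_2)$ is a circular homomorphism if for every acyclic $A \subseteq V(D_2)$, $\phi^{ -1}(A)$ is acyclic in $D_1$. An acyclic $(k,d)$-colouring ($k\ge d\ge1$ integers) of a digraph $D$ is a map $c: V(D)\to\mathbb{Z}_k$ such that $c^{ -1}(\{i,\dots,i+d-1\})$ is acyclic for every $i\in\mathbb{Z}_k$; the star dichromatic number $\vec{\chi}^\ast(D)$ is the infimum of $k/d$ over all acyclic $(k,d)$-colourings of $D$. Let $\mathcal{A}(D)$ be the family of acyclic vertex sets of $D$ and $\mathcal{A}(D,v)$ those containing $v$. The fractional dichromatic number $\vec{\chi}_f(D)$ is the optimal value of the linear program: minimize $\sum_{A\in\mathcal{A}(D)} x_A$ subject to $\sum_{A \in \mathcal{A}(D,v)} x_A \ge 1$ for all $v \in V(D)$ and $x \ge 0$.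
   Formalization: The feasible vectors x of the linear program defining $\vec{\chi}_f(D)$ have rational entries. -}

module Defs where

open import Data.Nat using (ℕ; zero; suc; _∸_; _≤ᵇ_; _<ᵇ_) renaming (_+_ to _+ℕ_; _≤_ to _≤ℕ_)
open import Data.Fin using (Fin; toℕ)
open import Data.Fin.Subset using (Subset; _∈_; inside; outside)
open import Data.Bool using (Bool; true; false; if_then_else_)
open import Data.Vec using (Vec; []; _∷_; lookup; tabulate)
open import Data.List using (List; []; _∷_; map; _++_)
open import Data.Integer using (+_)
open import Data.Rational using (ℚ; 0ℚ; 1ℚ; _/_; _≤_; _+_)
open import Relation.Binary.PropositionalEquality using (_≡_)
open import Data.Product using (Σ; _×_)
open import Relation.Nullary using (¬_)

-- Parallel arcs are irrelevant to
-- every notion used (only acyclicity of vertex sets matters), so arcs are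
-- recorded by an arc relation; anti-parallel arcs are allowed.
record Digraph : Set₁ where
  field
    size     : ℕ
    arc      : Fin size → Fin size → Set
    loopless : ∀ v → ¬ arc v v
open Digraph public

data Walk (D : Digraph) (S : Subset (size D)) : Fin (size D) → Fin (size D) → Set where
  step : ∀ {u w} → u ∈ S → w ∈ S → arc D u w → Walk D S u w
  _▸_  : ∀ {u v w} → Walk D S u v → Walk D S v w → Walk D S u w

Acyclic : (D : Digraph) → Subset (size D) → Set
Acyclic D S = ∀ v → ¬ Walk D S v v

preimage : ∀ {n m} → (Fin n → Fin m) → Subset m → Subset n
preimage φ A = tabulate (λ v → lookup A (φ v))

CircularHom : (D₁ D₂ : Digraph) → (Fin (size D₁) → Fin (size D₂)) → Set
CircularHom D₁ D₂ φ = ∀ A → Acyclic D₂ A → Acyclic D₁ (preimage φ A)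

-- For a b < k: the representative in {0,…,k-1} of (a - b) mod k.
offset : ℕ → ℕ → ℕ → ℕ
offset k a b = if b ≤ᵇ a then a ∸ b else (a +ℕ k) ∸ b

-- c⁻¹({i, i+1, …, i+d-1}) (indices in ℤ_k = Fin k)
colourInterval : ∀ {n k} → (Fin n → Fin k) → Fin k → ℕ → Subset n
colourInterval {k = k} c i d = tabulate (λ v → offset k (toℕ (c v)) (toℕ i) <ᵇ d)

AcyclicColouring : (D : Digraph) (k d : ℕ) → (Fin (size D) → Fin k) → Set
AcyclicColouring D k d c =
  (1 ≤ℕ d) × (d ≤ℕ k) × (∀ i → Acyclic D (colourInterval c i d))

-- the rational k/d (only used with d ≥ 1)
ratio : ℕ → ℕ → ℚ
ratio k zero    = 0ℚ
ratio k (suc d) = (+ k) / suc d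

allSubsets : (n : ℕ) → List (Subset n)
allSubsets zero    = [] ∷ []
allSubsets (suc n) = map (inside ∷_) (allSubsets n) ++ map (outside ∷_) (allSubsets n)

sumℚ : List ℚ → ℚ
sumℚ []       = 0ℚ
sumℚ (q ∷ qs) = q + sumℚ qs

-- objective: Σ_A x_A  (x_A is only nonzero on acyclic A, see Feasible)
lpValue : (D : Digraph) → (Subset (size D) → ℚ) → ℚ
lpValue D x = sumℚ (map x (allSubsets (size D)))

coverage : (D : Digraph) → (Subset (size D) → ℚ) → Fin (size D) → ℚ
coverage D x v = sumℚ (map (λ A → if lookup A v then x A else 0ℚ) (allSubsets (size D)))

-- feasible (rational) solution of the fractional dichromatic LP: a vector
-- indexed by 𝒜(D), encoded as a function on all subsets vanishing off 𝒜(D).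
Feasible : (D : Digraph) → (Subset (size D) → ℚ) → Set
Feasible D x =
  (∀ A → 0ℚ ≤ x A) ×
  (∀ A → ¬ (x A ≡ 0ℚ) → Acyclic D A) ×
  (∀ v → 1ℚ ≤ coverage D x v)

-- Both inequalities come from pulling structures on D₂ back along φ.  A colouring c of D₂
-- gives the colouring c ∘ φ of D₁ with the same k and d: its colour intervals are preimages
-- of those of c, hence acyclic.  A fractional solution x of D₂ gives the solution of D₁
-- that puts on B the total weight of all A with φ⁻¹(A) = B: every B receiving weight is
-- the preimage of an acyclic set, v ∈ φ⁻¹(A) iff φ(v) ∈ A makes the coverage of v equal to
-- that of φ(v), and the objective value is unchanged.  So every value attained for D₂ is
-- attained exactly for D₁.
module Submission where

open import Defs
open import Data.Nat using (ℕ; zero; suc; _<ᵇ_)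
open import Data.Fin using (Fin; toℕ)
open import Data.Fin.Subset using (Subset; inside; outside)
open import Data.Rational using (ℚ; 0ℚ; 1ℚ; _<_; _+_; _≤_)
import Data.Rational.Properties as ℚ
open import Algebra.Bundles using (CommutativeMonoid)
open import Algebra.Properties.CommutativeSemigroup
  (CommutativeMonoid.commutativeSemigroup ℚ.+-0-commutativeMonoid) using (interchange)
open import Data.Product using (Σ; _×_; _,_)
open import Data.List using (List; []; _∷_; map; _++_)
open import Data.Vec using ([]; _∷_; lookup; tabulate; tail)
open import Data.Vec.Properties using (lookup∘tabulate; tabulate-cong; ≡-dec)
open import Data.Bool using (Bool; true; false; if_then_else_)
import Data.Bool.Properties as Bool
open import Function using (_∘_)
open import Relation.Nullary using (does; yes; no)
open import Relation.Nullary.Decidable using (dec-true; dec-false; decidable-stable)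
open import Relation.Binary.Definitions using (DecidableEquality)
open import Relation.Binary.PropositionalEquality

private variable
  A B : Set

sumOver : List A → (A → ℚ) → ℚ
sumOver L f = sumℚ (map f L)

syntax sumOver L (λ a → e) = ∑[ a ∈ L ] e

sum-++ : (L M : List A) (f : A → ℚ) → sumOver (L ++ M) f ≡ sumOver L f + sumOver M f
sum-++ []      M f = sym (ℚ.+-identityˡ _)
sum-++ (a ∷ L) M f = trans (cong (f a +_) (sum-++ L M f)) (sym (ℚ.+-assoc (f a) _ _))

sum-map : (L : List B) (g : B → A) (f : A → ℚ) →
          sumOver (map g L) f ≡ sumOver L (f ∘ g)
sum-map []      g f = refl
sum-map (b ∷ L) g f = cong (f (g b) +_) (sum-map L g f)

sum-cong : (L : List A) {f g : A → ℚ} → (∀ a → f a ≡ g a) → sumOver L f ≡ sumOver L g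
sum-cong []      f≗g = refl
sum-cong (a ∷ L) f≗g = cong₂ _+_ (f≗g a) (sum-cong L f≗g)

sum-zero : (L : List A) {f : A → ℚ} → (∀ a → f a ≡ 0ℚ) → sumOver L f ≡ 0ℚ
sum-zero L f≗0 = trans (sum-cong L f≗0) (zeros L)
  where
  zeros : (L : List A) → ∑[ a ∈ L ] 0ℚ ≡ 0ℚ
  zeros []      = refl
  zeros (_ ∷ L) = trans (cong (0ℚ +_) (zeros L)) (ℚ.+-identityˡ 0ℚ)

sum-distrib-+ : (L : List A) (f g : A → ℚ) →
                ∑[ a ∈ L ] (f a + g a) ≡ sumOver L f + sumOver L g
sum-distrib-+ []      f g = sym (ℚ.+-identityˡ 0ℚ)
sum-distrib-+ (a ∷ L) f g =
  trans (cong (f a + g a +_) (sum-distrib-+ L f g)) (interchange (f a) (g a) _ _)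

sum-comm : (L : List A) (M : List B) (F : A → B → ℚ) →
           ∑[ a ∈ L ] sumOver M (F a) ≡ ∑[ b ∈ M ] ∑[ a ∈ L ] F a b
sum-comm []      M F = sym (sum-zero M (λ _ → refl))
sum-comm (a ∷ L) M F =
  trans (cong (sumOver M (F a) +_) (sum-comm L M F))
        (sym (sum-distrib-+ M (F a) (λ b → ∑[ a ∈ L ] F a b)))

sum-nonneg : (L : List A) {f : A → ℚ} → (∀ a → 0ℚ ≤ f a) → 0ℚ ≤ sumOver L f
sum-nonneg []      f≥0 = ℚ.≤-refl
sum-nonneg (a ∷ L) {f} f≥0 =
  subst (_≤ f a + sumOver L f) (ℚ.+-identityˡ 0ℚ) (ℚ.+-mono-≤ (f≥0 a) (sum-nonneg L f≥0))

if-sum : (b : Bool) (L : List A) (f : A → ℚ) →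
         (if b then sumOver L f else 0ℚ) ≡ ∑[ a ∈ L ] (if b then f a else 0ℚ)
if-sum true  L f = refl
if-sum false L f = sym (sum-zero L (λ _ → refl))

if-zero : (b : Bool) {q : ℚ} → q ≡ 0ℚ → (if b then q else 0ℚ) ≡ 0ℚ
if-zero true  q≡0 = q≡0
if-zero false q≡0 = refl

if-nonneg : (b : Bool) {q : ℚ} → 0ℚ ≤ q → 0ℚ ≤ (if b then q else 0ℚ)
if-nonneg true  q≥0 = q≥0
if-nonneg false q≥0 = ℚ.≤-refl

sum-allSubsets-suc : ∀ n (h : Subset (suc n) → ℚ) →
  sumOver (allSubsets (suc n)) h ≡
  sumOver (allSubsets n) (h ∘ (inside ∷_)) + sumOver (allSubsets n) (h ∘ (outside ∷_))
sum-allSubsets-suc n h =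
  trans (sum-++ (map (inside ∷_) (allSubsets n)) _ h)
        (cong₂ _+_ (sum-map (allSubsets n) _ h) (sum-map (allSubsets n) _ h))

sum-allSubsets-single : ∀ n (b : Subset n) (h : Subset n → ℚ) →
  (∀ B → B ≢ b → h B ≡ 0ℚ) → sumOver (allSubsets n) h ≡ h b
sum-allSubsets-single zero [] h off-b = ℚ.+-identityʳ _
sum-allSubsets-single (suc n) (true ∷ b) h off-b = begin
  sumOver (allSubsets (suc n)) h
    ≡⟨ sum-allSubsets-suc n h ⟩
  sumOver (allSubsets n) (h ∘ (inside ∷_)) + sumOver (allSubsets n) (h ∘ (outside ∷_))
    ≡⟨ cong₂ _+_ (sum-allSubsets-single n b (h ∘ (inside ∷_)) (λ B B≢b → off-b _ (B≢b ∘ cong tail)))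
                 (sum-zero (allSubsets n) (λ _ → off-b _ (λ ()))) ⟩
  h (true ∷ b) + 0ℚ
    ≡⟨ ℚ.+-identityʳ _ ⟩
  h (true ∷ b) ∎
  where open ≡-Reasoning
sum-allSubsets-single (suc n) (false ∷ b) h off-b = begin
  sumOver (allSubsets (suc n)) h
    ≡⟨ sum-allSubsets-suc n h ⟩
  sumOver (allSubsets n) (h ∘ (inside ∷_)) + sumOver (allSubsets n) (h ∘ (outside ∷_))
    ≡⟨ cong₂ _+_ (sum-zero (allSubsets n) (λ _ → off-b _ (λ ())))
                 (sum-allSubsets-single n b (h ∘ (outside ∷_)) (λ B B≢b → off-b _ (B≢b ∘ cong tail))) ⟩
  0ℚ + h (false ∷ b)
    ≡⟨ ℚ.+-identityˡ _ ⟩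
  h (false ∷ b) ∎
  where open ≡-Reasoning

_≟ₛ_ : ∀ {n} → DecidableEquality (Subset n)
_≟ₛ_ = ≡-dec Bool._≟_

pushforward : ∀ {m n} → (Subset m → Subset n) → (Subset m → ℚ) → Subset n → ℚ
pushforward {m} f x B = ∑[ A ∈ allSubsets m ] (if does (f A ≟ₛ B) then x A else 0ℚ)

module _ {m n} (f : Subset m → Subset n) (x : Subset m → ℚ) where

  pushforward-nonneg : (∀ A → 0ℚ ≤ x A) → ∀ B → 0ℚ ≤ pushforward f x B
  pushforward-nonneg x≥0 B = sum-nonneg (allSubsets m) (λ A → if-nonneg (does (f A ≟ₛ B)) (x≥0 A))

  pushforward-vanishes : ∀ B → (∀ A → f A ≡ B → x A ≡ 0ℚ) → pushforward f x B ≡ 0ℚ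
  pushforward-vanishes B fibre≡0 = sum-zero (allSubsets m) vanishes
    where
    vanishes : ∀ A → (if does (f A ≟ₛ B) then x A else 0ℚ) ≡ 0ℚ
    vanishes A with f A ≟ₛ B
    ... | yes fA≡B = fibre≡0 A fA≡B
    ... | no  _    = refl

  sum-pushforward : (w : Subset n → Bool) →
    ∑[ B ∈ allSubsets n ] (if w B then pushforward f x B else 0ℚ) ≡
    ∑[ A ∈ allSubsets m ] (if w (f A) then x A else 0ℚ)
  sum-pushforward w = begin
    ∑[ B ∈ allSubsets n ] (if w B then pushforward f x B else 0ℚ)
      ≡⟨ sum-cong (allSubsets n) (λ B → if-sum (w B) (allSubsets m) (term B)) ⟩
    ∑[ B ∈ allSubsets n ] ∑[ A ∈ allSubsets m ] (if w B then term B A else 0ℚ)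
      ≡⟨ sum-comm (allSubsets n) (allSubsets m) _ ⟩
    ∑[ A ∈ allSubsets m ] ∑[ B ∈ allSubsets n ] (if w B then term B A else 0ℚ)
      ≡⟨ sum-cong (allSubsets m) (λ A → sum-allSubsets-single n (f A) _ (off-fibre A)) ⟩
    ∑[ A ∈ allSubsets m ] (if w (f A) then term (f A) A else 0ℚ)
      ≡⟨ sum-cong (allSubsets m) (λ A → cong (λ b → if w (f A) then (if b then x A else 0ℚ) else 0ℚ)
                                                  (dec-true (f A ≟ₛ f A) refl)) ⟩
    ∑[ A ∈ allSubsets m ] (if w (f A) then x A else 0ℚ) ∎
    where
    open ≡-Reasoning
    term : Subset n → Subset m → ℚ
    term B A = if does (f A ≟ₛ B) then x A else 0ℚ
    off-fibre : ∀ A B → B ≢ f A → (if w B then term B A else 0ℚ) ≡ 0ℚ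
    off-fibre A B B≢fA =
      if-zero (w B) (cong (λ b → if b then x A else 0ℚ) (dec-false (f A ≟ₛ B) (B≢fA ∘ sym)))

lpValue-pushforward : (D₁ D₂ : Digraph) (f : Subset (size D₂) → Subset (size D₁))
  (x : Subset (size D₂) → ℚ) → lpValue D₁ (pushforward f x) ≡ lpValue D₂ x
lpValue-pushforward D₁ D₂ f x = sum-pushforward f x (λ _ → true)

module _ {D₁ D₂ : Digraph} (φ : Fin (size D₁) → Fin (size D₂)) where

  coverage-pushforward-preimage : (x : Subset (size D₂) → ℚ) (v : Fin (size D₁)) →
    coverage D₁ (pushforward (preimage φ) x) v ≡ coverage D₂ x (φ v)
  coverage-pushforward-preimage x v =
    trans (sum-pushforward (preimage φ) x (λ B → lookup B v))
          (sum-cong (allSubsets (size D₂))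
            (λ A → cong (λ b → if b then x A else 0ℚ) (lookup∘tabulate (lookup A ∘ φ) v)))

  feasible-pushforward-preimage : CircularHom D₁ D₂ φ → (x : Subset (size D₂) → ℚ) →
    Feasible D₂ x → Feasible D₁ (pushforward (preimage φ) x)
  feasible-pushforward-preimage hom x (x≥0 , support-acyclic , covered) =
    pushforward-nonneg (preimage φ) x x≥0 ,
    (λ B y≢0 v cycle → y≢0 (pushforward-vanishes (preimage φ) x B (fibre≡0 B v cycle))) ,
    (λ v → subst (1ℚ ≤_) (sym (coverage-pushforward-preimage x v)) (covered (φ v)))
    where
    fibre≡0 : ∀ B v → Walk D₁ B v v → ∀ A → preimage φ A ≡ B → x A ≡ 0ℚ
    fibre≡0 B v cycle A refl = decidable-stable (x A ℚ.≟ 0ℚ)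
      (λ xA≢0 → hom A (support-acyclic A xA≢0) v cycle)

  colourInterval-∘ : ∀ {k} (c : Fin (size D₂) → Fin k) i d →
    colourInterval (c ∘ φ) i d ≡ preimage φ (colourInterval c i d)
  colourInterval-∘ {k} c i d =
    sym (tabulate-cong (lookup∘tabulate (λ u → offset k (toℕ (c u)) (toℕ i) <ᵇ d) ∘ φ))

  acyclicColouring-∘ : CircularHom D₁ D₂ φ → ∀ {k d} (c : Fin (size D₂) → Fin k) →
    AcyclicColouring D₂ k d c → AcyclicColouring D₁ k d (c ∘ φ)
  acyclicColouring-∘ hom {d = d} c (d≥1 , d≤k , intervals-acyclic) =
    d≥1 , d≤k , λ i → subst (Acyclic D₁) (sym (colourInterval-∘ c i d)) (hom _ (intervals-acyclic i))

<-+-pos : ∀ q {ε} → 0ℚ < ε → q < q + ε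
<-+-pos q ε>0 = subst (_< q + _) (ℚ.+-identityʳ q) (ℚ.+-monoʳ-< q ε>0)

mainTheorem4 : (D₁ D₂ : Digraph) (φ : Fin (size D₁) → Fin (size D₂)) →
    CircularHom D₁ D₂ φ →
    ((k d : ℕ) (c : Fin (size D₂) → Fin k) → AcyclicColouring D₂ k d c →
      (ε : ℚ) → 0ℚ < ε →
      Σ ℕ (λ k′ → Σ ℕ (λ d′ → Σ (Fin (size D₁) → Fin k′) (λ c′ →
        AcyclicColouring D₁ k′ d′ c′ × (ratio k′ d′ < ratio k d + ε)))))
    ×
    ((x : Subset (size D₂) → ℚ) → Feasible D₂ x →
      (ε : ℚ) → 0ℚ < ε →
      Σ (Subset (size D₁) → ℚ) (λ y →
        Feasible D₁ y × (lpValue D₁ y < lpValue D₂ x + ε)))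
mainTheorem4 D₁ D₂ φ hom =
  (λ k d c colouring ε ε>0 →
     k , d , c ∘ φ , acyclicColouring-∘ φ hom c colouring , <-+-pos (ratio k d) ε>0) ,
  (λ x feasible ε ε>0 →
     pushforward (preimage φ) x ,
     feasible-pushforward-preimage φ hom x feasible ,
     subst (_< lpValue D₂ x + ε) (sym (lpValue-pushforward D₁ D₂ (preimage φ) x)) (<-+-pos _ ε>0))
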